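{- Let $P$ be a $k$-regular contractible polycell and let $Q$ and $Q'$ be two tilings of $P$. Then the functions $\max(\varphi_Q,\varphi_{Q'})$ and $\min(\varphi_Q,\varphi_{Q'})$ (taken pointwise on the vertices of $P$) are the height functions of tilings of $P$.
   Context: Let $G$ be a simple directed graph (no loops, no multiple edges, and if $(v,v')$ is an edge then $(v',v)$ is not). Fix a set $\Theta$ of elementary directed circuits of $G$, called cells. A polycell $P$ is a set of cells of $\Theta$; its edges and vertices are those of its cells. $P$ is $k$-regular if every cell of $P$ is a circuit of length $k$. The boundary $\partial P$ is an arbitrarily distinguished set of edges of $P$; a vertex is on the boundary if it is an endpoint of an edge of $\partial P$. It is assumed that any set of cells of $P$ has at most one edge in common. For an edge $e$ of $P$ not in $\partial P$, the set of all cells of $P$ containing $e$ is a tile. A tiling of $P$ is a partition of the cells of $P$ into tiles; for a tile $t$ of a tiling $Q$ the unique edge common to the cells of $t$ is a tiling edge of $Q$. A flow on $P$ is a map from edges of $P$ to $\mathbb{Z}$. A travel from $s$ to $s'$ is a set of edges of $P$ forming, orientations forgotten, a path from $s$ to $s'$; it is closed if it forms a cycle. The flux is $F_T(C)=\sum_{e\in T^+}C(e)-\sum_{e\in T^- }C(e)$ with $T^+$ (resp. $T^-$) the edges traversed along (resp. against) their direction. For a cell $c$, $T_c$ is the closed travel around $c$. $C$ is a tension if $F_T(C)=0$ for all closed travels $T$ in $P$. $P$ has a balanced boundary if, for a flow $C$ with $C(e)=1$ on $\partial P$, $F_T(C)=0$ for every closed travel $T$ made of edges of $\partial P$. $P$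 is contractible if it has a balanced boundary and a flow $C$ on $P$ is a tension iff $F_{T_c}(C)=0$ for all cells $c$ of $P$. For a tiling $Q$ of a $k$-regular $P$, $C_Q(e)=1-k$ if $e$ is a tiling edge of $Q$, $C_Q(e)=1$ otherwise. Fix a vertex $\nu$ on the boundary. The height function $\varphi_Q$ of $Q$ is the potential of $C_Q$: $\varphi_Q(\nu)=0$ and $\varphi_Q(y)-\varphi_Q(x)=F_T(C_Q)$ for any travel $T$ from $x$ to $y$. -}

module Defs where

open import Data.Nat using (ℕ; zero; suc; _≤_)
open import Data.Nat.Properties using () renaming (_≟_ to _≟ℕ_)
open import Data.Integer as ℤ using (ℤ; +_; -_; _+_; _-_; _⊔_; _⊓_)
open import Data.Fin using (Fin)
open import Data.List using (List; []; _∷_; length)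
open import Data.List.Relation.Unary.All using (All)
open import Data.List.Relation.Unary.Unique.Propositional using (Unique)
open import Data.List.Membership.Propositional using (_∈_; _∉_)
open import Data.Product using (Σ; ∃; _×_; _,_; proj₁; proj₂)
open import Data.Product.Properties using (≡-dec)
open import Data.Sum using (_⊎_)
open import Data.Bool using (if_then_else_)
open import Relation.Nullary using (¬_; does)
open import Relation.Binary.PropositionalEquality using (_≡_; _≢_)
open import Function.Bundles using (_⇔_)
open import Level using (0ℓ) renaming (suc to lsuc)

Edge : Set
Edge = ℕ × ℕ

_≟E_ : (e e' : Edge) → Relation.Nullary.Dec (e ≡ e')
_≟E_ = ≡-dec _≟ℕ_ _≟ℕ_

open import Data.List.Membership.DecPropositional _≟E_ using (_∈?_)

-- The edges of the circuit given by the cyclic list of vertices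
-- v₀ v₁ … vₘ : (v₀,v₁), (v₁,v₂), …, (vₘ,v₀).
cellEdges : List ℕ → List Edge
cellEdges [] = []
cellEdges (v ∷ vs) = go (v ∷ vs)
  where
  go : List ℕ → List Edge
  go [] = []
  go (x ∷ []) = (x , v) ∷ []
  go (x ∷ y ∷ r) = (x , y) ∷ go (y ∷ r)

record Graph : Set₁ where
  field
    E      : ℕ → ℕ → Set
    noLoop : ∀ v → ¬ E v v
    asym   : ∀ u v → E u v → ¬ E v u

  IsCircuit : List ℕ → Set
  IsCircuit c = (c ≢ []) × Unique c × All (λ e → E (proj₁ e) (proj₂ e)) (cellEdges c)

record GraphWithCells : Set₁ where
  field
    graph    : Graph
    Θ        : List ℕ → Set
    Θ-circ   : ∀ c → Θ c → Graph.IsCircuit graph c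
  open Graph graph public

record Polycell (G : GraphWithCells) : Set₁ where
  open GraphWithCells G
  field
    n        : ℕ
    cell     : Fin n → List ℕ
    cell∈Θ   : ∀ i → Θ (cell i)
    boundary : List Edge

  field
    boundary⊆ : ∀ e → e ∈ boundary → ∃ λ i → e ∈ cellEdges (cell i)
    -- any set of (at least two, i.e. distinct) cells has at most one common edge
    atMostOneCommon : ∀ i j → i ≢ j → ∀ e e' →
      e ∈ cellEdges (cell i) → e ∈ cellEdges (cell j) →
      e' ∈ cellEdges (cell i) → e' ∈ cellEdges (cell j) → e ≡ e'

module _ {G : GraphWithCells} (P : Polycell G) where
  open Polycell P

  EdgeOf : Edge → Set
  EdgeOf e = ∃ λ i → e ∈ cellEdges (cell i)

  VertexOf : ℕ → Set
  VertexOf v = ∃ λ i → v ∈ cell i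

  OnBoundary : ℕ → Set
  OnBoundary v = ∃ λ e → e ∈ boundary × (proj₁ e ≡ v ⊎ proj₂ e ≡ v)

  Regular : ℕ → Set
  Regular k = ∀ i → length (cell i) ≡ k

  Flow : Set
  Flow = Edge → ℤ

  -- Travels (walks in P, orientations forgotten), recording the direction
  -- in which each edge is traversed.
  data Travel : ℕ → ℕ → Set where
    stop : ∀ {x} → Travel x x
    fwd  : ∀ {x y z} → EdgeOf (x , y) → Travel y z → Travel x z
    bwd  : ∀ {x y z} → EdgeOf (y , x) → Travel y z → Travel x z

  stops : ∀ {x y} → Travel x y → List ℕ
  stops stop = []
  stops (fwd {y = y} _ T) = y ∷ stops T
  stops (bwd {y = y} _ T) = y ∷ stops T

  travelEdges : ∀ {x y} → Travel x y → List Edge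
  travelEdges stop = []
  travelEdges (fwd {x} {y} _ T) = (x , y) ∷ travelEdges T
  travelEdges (bwd {x} {y} _ T) = (y , x) ∷ travelEdges T

  IsPath : ∀ {x y} → Travel x y → Set
  IsPath {x} T = Unique (x ∷ stops T)

  IsClosed : ∀ {x} → Travel x x → Set
  IsClosed T = (3 ≤ length (stops T)) × Unique (stops T)

  flux : Flow → ∀ {x y} → Travel x y → ℤ
  flux C stop = + 0
  flux C (fwd {x} {y} _ T) = C (x , y) + flux C T
  flux C (bwd {x} {y} _ T) = (- C (y , x)) + flux C T

  -- Flux around a cell c (the closed travel T_c, all edges forward)
  cellFlux : Flow → List ℕ → ℤ
  cellFlux C c = go (cellEdges c)
    where
    go : List Edge → ℤ
    go [] = + 0
    go (e ∷ es) = C e + go es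

  IsTension : Flow → Set
  IsTension C = ∀ x (T : Travel x x) → IsClosed T → flux C T ≡ + 0

  BalancedBoundary : Set
  BalancedBoundary = ∀ (C : Flow) → (∀ e → e ∈ boundary → C e ≡ + 1) →
    ∀ x (T : Travel x x) → IsClosed T → All (_∈ boundary) (travelEdges T) →
    flux C T ≡ + 0

  Contractible : Set
  Contractible = BalancedBoundary ×
    (∀ (C : Flow) → IsTension C ⇔ (∀ i → cellFlux C (cell i) ≡ + 0))

  ConnectedFrom : ℕ → Set
  ConnectedFrom ν = ∀ v → VertexOf v → ∃ λ (T : Travel ν v) → IsPath T

  InTile : Edge → Fin n → Set
  InTile e i = e ∈ cellEdges (cell i)

  -- A tiling: a set of tiling edges (non-boundary edges of P) whose tiles
  -- partition the cells, i.e. every cell lies in exactly one tile.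
  record Tiling : Set where
    field
      tilingEdges : List Edge
      edgeOfP     : ∀ e → e ∈ tilingEdges → EdgeOf e
      notBoundary : ∀ e → e ∈ tilingEdges → e ∉ boundary
      partition   : ∀ i → ∃ λ e → e ∈ tilingEdges × InTile e i ×
                      (∀ e' → e' ∈ tilingEdges → InTile e' i → e' ≡ e)

  C[_] : ℕ → Tiling → Flow
  C[ k ] Q e = if does (e ∈? Tiling.tilingEdges Q) then (+ 1) - (+ k) else + 1

  IsHeight : ℕ → ℕ → Tiling → (ℕ → ℤ) → Set
  IsHeight k ν Q φ = (φ ν ≡ + 0) ×
    (∀ x y (T : Travel x y) → IsPath T → φ y - φ x ≡ flux (C[ k ] Q) T)

{-# OPTIONS --safe #-}
module Submission where

open import Defs
open import Data.Nat using (ℕ)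
open import Data.Integer using (ℤ; _⊔_; _⊓_)
open import Data.Product using (Σ; ∃; _×_; _,_)

open import Data.Product using (proj₁; proj₂)
open import Data.Nat as ℕ using (NonZero)
import Data.Nat.Properties as ℕ
import Data.Nat.Divisibility as ℕ
open import Data.Integer
  using (+_; +[1+_]; 0ℤ; 1ℤ; -1ℤ; -_; _+_; _-_; _*_; _≤_; _<_; +≤+; +<+)
open import Data.Integer.Properties
open import Data.Integer.Divisibility.Signed using (_∣_; divides; ∣⇒∣ᵤ; ∣m∣n⇒∣m+n; ∣m⇒∣-m)
open import Data.Integer.Tactic.RingSolver using (solve-∀)
open import Data.Fin using (Fin)
open import Data.List using (List; []; _∷_; length; drop; filter; concatMap; allFin)
open import Data.List.Relation.Unary.All as All using (All; []; _∷_)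
open import Data.List.Relation.Unary.Any as Any using (here; there)
import Data.List.Relation.Unary.AllPairs as AllPairs
open import Data.List.Membership.Propositional using (_∈_; _∉_)
open import Data.List.Membership.Propositional.Properties
  using (∈-filter⁺; ∈-filter⁻; ∈-concatMap⁺; ∈-concatMap⁻; ∈-allFin)
open import Data.List.Membership.DecPropositional _≟E_ using (_∈?_)
open import Data.Sum as Sum using (_⊎_; inj₁; inj₂)
open import Function using (_∘_)
open import Relation.Nullary using (yes; no; contradiction)
open import Relation.Unary using (Decidable)
open import Relation.Binary.Definitions using (tri<; tri≈; tri>)
open import Relation.Binary.PropositionalEquality

-- Along every edge a height function increases by 1 or by 1 - k, and two height
-- functions differ by a multiple of k at every vertex (compare them along a travel
-- from ν).  So where φ > φ' we even have φ ≥ φ' + k, and one edge later φ is still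
-- ≥ φ'; hence along each edge max(φ, φ') and min(φ, φ') increase exactly as φ or
-- as φ' does.  A potential whose increments are all 1 or 1 - k, and 1 on the
-- boundary, is a height function: its tiling edges are those with increment 1 - k,
-- and each cell, of length k, carries exactly one of them because the increments
-- around a cell sum to 0.

Step : ℕ → ℤ → Set
Step k δ = δ ≡ + 1 ⊎ δ ≡ + 1 - + k

one-minus-involutive : ∀ a → + 1 - (+ 1 - a) ≡ a
one-minus-involutive = solve-∀

step-values-distinct : ∀ k .{{_ : NonZero k}} → + 1 ≢ + 1 - + k
step-values-distinct k 1≡1-k = ℕ.≢-nonZero⁻¹ k (+-injective (begin
  + k                 ≡⟨ one-minus-involutive (+ k) ⟨
  + 1 - (+ 1 - + k)   ≡⟨ cong (_-_ 1ℤ) 1≡1-k ⟨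
  + 1 - + 1           ≡⟨⟩
  0ℤ                  ∎))
  where open ≡-Reasoning

step≤1 : ∀ {k δ} → Step k δ → δ ≤ + 1
step≤1 (inj₁ refl) = ≤-refl
step≤1 {k} (inj₂ refl) = i-j≤i (+ 1) (+ k)

1-k≤step : ∀ {k δ} → Step k δ → + 1 - + k ≤ δ
1-k≤step {k} (inj₁ refl) = i-j≤i (+ 1) (+ k)
1-k≤step (inj₂ refl) = ≤-refl

steps-congruent : ∀ {k δ δ'} → Step k δ → Step k δ' → + k ∣ δ - δ'
steps-congruent (inj₁ refl) (inj₁ refl) = divides 0ℤ refl
steps-congruent {k} (inj₁ refl) (inj₂ refl) =
  divides 1ℤ (trans (one-minus-involutive (+ k)) (sym (*-identityˡ (+ k))))
steps-congruent {k} (inj₂ refl) (inj₁ refl) = divides -1ℤ (raise-step (+ k))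
  where
  raise-step : ∀ K → (+ 1 - K) - + 1 ≡ -1ℤ * K
  raise-step = solve-∀
steps-congruent {k} (inj₂ refl) (inj₂ refl) = divides 0ℤ (+-inverseʳ (+ 1 - + k))

neg-minus : ∀ a b → - (a - b) ≡ b - a
neg-minus = solve-∀

minus-+-cancel : ∀ a b → a + (b - a) ≡ b
minus-+-cancel = solve-∀

minus-+-interchange : ∀ a a' b b' → (a + b) - (a' + b') ≡ (a - a') + (b - b')
minus-+-interchange = solve-∀

minus-telescope : ∀ a b c → (b - a) + (c - b) ≡ c - a
minus-telescope a b c = trans (+-comm (b - a) (c - b)) (+-minus-telescope c b a)

divisor-≤ : ∀ {k d} → + k ∣ d → 0ℤ < d → + k ≤ d
divisor-≤ {d = +[1+ m ]} k∣d _ = +≤+ (ℕ.∣⇒≤ (∣⇒∣ᵤ k∣d))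
divisor-≤ {d = + 0} _ (+<+ ())

-- a' + k ≤ a, and the increments can close the gap by at most k.
step-order : ∀ {k} a a' b b' → + k ∣ a - a' → a' < a →
  Step k (b - a) → Step k (b' - a') → b' ≤ b
step-order {k} a a' b b' k∣a-a' a'<a s s' = begin
  b'                        ≡⟨ minus-+-cancel a' b' ⟨
  a' + (b' - a')            ≤⟨ +-monoʳ-≤ a' (step≤1 {k} s') ⟩
  a' + + 1                  ≡⟨ shift-k a' (+ k) ⟩
  (a' + + k) + (+ 1 - + k)  ≤⟨ +-mono-≤ a'+k≤a (1-k≤step {k} s) ⟩
  a + (b - a)               ≡⟨ minus-+-cancel a b ⟩
  b                         ∎
  where
  open ≤-Reasoning
  shift-k : ∀ x K → x + + 1 ≡ (x + K) + (+ 1 - K)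
  shift-k = solve-∀
  0<a-a' : 0ℤ < a - a'
  0<a-a' = subst (_< a - a') (+-inverseʳ a') (+-monoˡ-< (- a') a'<a)
  a'+k≤a : a' + + k ≤ a
  a'+k≤a = ≤-trans (+-monoʳ-≤ a' (divisor-≤ k∣a-a' 0<a-a')) (≤-reflexive (minus-+-cancel a' a))

∣-swap : ∀ {k a a'} → k ∣ a - a' → k ∣ a' - a
∣-swap {a = a} {a'} k∣ = subst (_ ∣_) (neg-minus a a') (∣m⇒∣-m k∣)

⊔-step : ∀ {k} a a' b b' → + k ∣ a - a' → Step k (b - a) → Step k (b' - a') →
  (b ⊔ b') - (a ⊔ a') ≡ b - a ⊎ (b ⊔ b') - (a ⊔ a') ≡ b' - a'
⊔-step a a' b b' k∣ s s' with <-cmp a a'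
... | tri< a<a' _ _ = inj₂ (cong₂ _-_ (i≤j⇒i⊔j≡j (step-order a' a b' b (∣-swap {a = a} {a'} k∣) a<a' s' s))
                                      (i≤j⇒i⊔j≡j (<⇒≤ a<a')))
... | tri≈ _ refl _ = Sum.map (λ e → cong₂ _-_ e (⊔-idem a)) (λ e → cong₂ _-_ e (⊔-idem a)) (⊔-sel b b')
... | tri> _ _ a'<a = inj₁ (cong₂ _-_ (i≥j⇒i⊔j≡i (step-order a a' b b' k∣ a'<a s s'))
                                      (i≥j⇒i⊔j≡i (<⇒≤ a'<a)))

⊓-step : ∀ {k} a a' b b' → + k ∣ a - a' → Step k (b - a) → Step k (b' - a') →
  (b ⊓ b') - (a ⊓ a') ≡ b - a ⊎ (b ⊓ b') - (a ⊓ a') ≡ b' - a'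
⊓-step a a' b b' k∣ s s' with <-cmp a a'
... | tri< a<a' _ _ = inj₁ (cong₂ _-_ (i≤j⇒i⊓j≡i (step-order a' a b' b (∣-swap {a = a} {a'} k∣) a<a' s' s))
                                      (i≤j⇒i⊓j≡i (<⇒≤ a<a')))
... | tri≈ _ refl _ = Sum.map (λ e → cong₂ _-_ e (⊓-idem a)) (λ e → cong₂ _-_ e (⊓-idem a)) (⊓-sel b b')
... | tri> _ _ a'<a = inj₂ (cong₂ _-_ (i≥j⇒i⊓j≡j (step-order a a' b b' k∣ a'<a s s'))
                                      (i≥j⇒i⊓j≡j (<⇒≤ a'<a)))

sumOf : ∀ {A : Set} → (A → ℤ) → List A → ℤ
sumOf f [] = 0ℤ
sumOf f (x ∷ xs) = f x + sumOf f xs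

module _ {A : Set} (k : ℕ) (f : A → ℤ) where

  low? : Decidable (λ x → f x ≡ + 1 - + k)
  low? x = f x ≟ + 1 - + k

  sumOf-steps : ∀ xs → All (Step k ∘ f) xs →
    sumOf f xs + + k * + length (filter low? xs) ≡ + length xs
  sumOf-steps [] [] = trans (+-identityˡ _) (*-zeroʳ (+ k))
  sumOf-steps (x ∷ xs) (s ∷ ss) with low? x | s
  ... | yes fx≡1-k | _ rewrite fx≡1-k =
    trans (low-step (sumOf f xs) (+ k) (+ length (filter low? xs)))
          (cong (_+_ 1ℤ) (sumOf-steps xs ss))
    where
    low-step : ∀ s K c → ((+ 1 - K) + s) + K * (+ 1 + c) ≡ + 1 + (s + K * c)
    low-step = solve-∀
  ... | no fx≢1-k | inj₂ fx≡1-k = contradiction fx≡1-k fx≢1-k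
  ... | no _ | inj₁ fx≡1 rewrite fx≡1 =
    trans (+-assoc (+ 1) (sumOf f xs) _) (cong (_+_ 1ℤ) (sumOf-steps xs ss))

increment : (ℕ → ℤ) → Edge → ℤ
increment ψ e = ψ (proj₂ e) - ψ (proj₁ e)

-- cellEdges (v ∷ xs) is (v , x₀) followed by the edges of the walk x₀ → x₁ → ⋯ → v,
-- which is what its local recursion runs along.
closingWalk : ℕ → List ℕ → List Edge
closingWalk v xs = drop 1 (cellEdges (v ∷ xs))

closingWalk-source : ∀ v x r {e} → e ∈ closingWalk v (x ∷ r) → proj₁ e ∈ x ∷ r
closingWalk-source v x []      (here refl) = here refl
closingWalk-source v x (y ∷ r) (here refl) = here refl
closingWalk-source v x (y ∷ r) (there e∈) = there (closingWalk-source v y r e∈)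

length-closingWalk : ∀ v x r → length (closingWalk v (x ∷ r)) ≡ length (x ∷ r)
length-closingWalk v x []      = refl
length-closingWalk v x (y ∷ r) = cong ℕ.suc (length-closingWalk v y r)

sumOf-increment-closingWalk : ∀ ψ v x r →
  sumOf (increment ψ) (closingWalk v (x ∷ r)) ≡ ψ v - ψ x
sumOf-increment-closingWalk ψ v x []      = +-identityʳ (ψ v - ψ x)
sumOf-increment-closingWalk ψ v x (y ∷ r) = begin
  (ψ y - ψ x) + sumOf (increment ψ) (closingWalk v (y ∷ r))
    ≡⟨ cong (_+_ (ψ y - ψ x)) (sumOf-increment-closingWalk ψ v y r) ⟩
  (ψ y - ψ x) + (ψ v - ψ y)  ≡⟨ minus-telescope (ψ x) (ψ y) (ψ v) ⟩
  ψ v - ψ x                  ∎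
  where open ≡-Reasoning

cellEdges-source : ∀ c {x y} → (x , y) ∈ cellEdges c → x ∈ c
cellEdges-source (v ∷ vs) = closingWalk-source v v vs

length-cellEdges : ∀ c → length (cellEdges c) ≡ length c
length-cellEdges []       = refl
length-cellEdges (v ∷ vs) = length-closingWalk v v vs

sumOf-increment-cellEdges : ∀ ψ c → sumOf (increment ψ) (cellEdges c) ≡ 0ℤ
sumOf-increment-cellEdges ψ []       = refl
sumOf-increment-cellEdges ψ (v ∷ vs) =
  trans (sumOf-increment-closingWalk ψ v v vs) (+-inverseʳ (ψ v))

module _ {G : GraphWithCells} (P : Polycell G) (k : ℕ) where
  open GraphWithCells G
  open Polycell P

  edge-irreflexive : ∀ {x y} → EdgeOf P (x , y) → x ≢ y
  edge-irreflexive (i , e∈) refl =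
    noLoop _ (All.lookup (proj₂ (proj₂ (Θ-circ (cell i) (cell∈Θ i)))) e∈)

  edge-source : ∀ {e} → EdgeOf P e → VertexOf P (proj₁ e)
  edge-source (i , e∈) = i , cellEdges-source (cell i) e∈

  regular-nonZero : Regular P k → Fin n → NonZero k
  regular-nonZero reg i with cell i | reg i | proj₁ (Θ-circ (cell i) (cell∈Θ i))
  ... | []    | _    | c≢[] = contradiction refl c≢[]
  ... | _ ∷ _ | refl | _    = _

  C-step : ∀ R e → Step k (C[_] P k R e)
  C-step R e with e ∈? Tiling.tilingEdges R
  ... | yes _ = inj₂ refl
  ... | no  _ = inj₁ refl

  C-boundary : ∀ R {e} → e ∈ boundary → C[_] P k R e ≡ + 1
  C-boundary R {e} e∈∂ with e ∈? Tiling.tilingEdges R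
  ... | yes e∈R = contradiction e∈∂ (Tiling.notBoundary R e e∈R)
  ... | no  _   = refl

  flux-cong : ∀ {C C'} → (∀ {e} → EdgeOf P e → C e ≡ C' e) →
    ∀ {x y} (T : Travel P x y) → flux P C T ≡ flux P C' T
  flux-cong C≡C' stop        = refl
  flux-cong C≡C' (fwd ed T) = cong₂ _+_ (C≡C' ed) (flux-cong C≡C' T)
  flux-cong C≡C' (bwd ed T) = cong₂ _+_ (cong -_ (C≡C' ed)) (flux-cong C≡C' T)

  flux-increment : ∀ ψ {x y} (T : Travel P x y) → flux P (increment ψ) T ≡ ψ y - ψ x
  flux-increment ψ {x} stop = sym (+-inverseʳ (ψ x))
  flux-increment ψ {x} {z} (fwd {y = y} _ T) = begin
    (ψ y - ψ x) + flux P (increment ψ) T  ≡⟨ cong (_+_ (ψ y - ψ x)) (flux-increment ψ T) ⟩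
    (ψ y - ψ x) + (ψ z - ψ y)             ≡⟨ minus-telescope (ψ x) (ψ y) (ψ z) ⟩
    ψ z - ψ x                             ∎
    where open ≡-Reasoning
  flux-increment ψ {x} {z} (bwd {y = y} _ T) = begin
    - (ψ x - ψ y) + flux P (increment ψ) T  ≡⟨ cong₂ _+_ (neg-minus (ψ x) (ψ y)) (flux-increment ψ T) ⟩
    (ψ y - ψ x) + (ψ z - ψ y)               ≡⟨ minus-telescope (ψ x) (ψ y) (ψ z) ⟩
    ψ z - ψ x                               ∎
    where open ≡-Reasoning

  flux-congruent : ∀ {C C'} → (∀ e → + k ∣ C e - C' e) →
    ∀ {x y} (T : Travel P x y) → + k ∣ flux P C T - flux P C' T
  flux-congruent k∣C-C' stop = divides 0ℤ refl
  flux-congruent {C} {C'} k∣C-C' (fwd {x} {y} _ T) =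
    subst (_ ∣_) (sym (minus-+-interchange (C (x , y)) (C' (x , y)) _ _))
      (∣m∣n⇒∣m+n (k∣C-C' (x , y)) (flux-congruent k∣C-C' T))
  flux-congruent {C} {C'} k∣C-C' (bwd {x} {y} _ T) =
    subst (_ ∣_) (sym (minus-+-interchange (- C (y , x)) (- C' (y , x)) _ _))
      (∣m∣n⇒∣m+n (subst (_ ∣_) (neg-distrib-+ (C (y , x)) (- C' (y , x))) (∣m⇒∣-m (k∣C-C' (y , x))))
                 (flux-congruent k∣C-C' T))

  height-increment : ∀ {ν} R φ → IsHeight P k ν R φ →
    ∀ {e} → EdgeOf P e → increment φ e ≡ C[_] P k R e
  height-increment R φ (_ , potential) {x , y} ed =
    trans (potential x y (fwd ed stop) single-edge-path) (+-identityʳ _)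
    where
    single-edge-path : IsPath P (fwd ed stop)
    single-edge-path = (edge-irreflexive ed ∷ []) AllPairs.∷ ([] AllPairs.∷ AllPairs.[])

  height-step : ∀ {ν} R φ → IsHeight P k ν R φ → ∀ {e} → EdgeOf P e → Step k (increment φ e)
  height-step R φ hR {e} ed = subst (Step k) (sym (height-increment R φ hR ed)) (C-step R e)

  height-value : ∀ {ν} R φ → IsHeight P k ν R φ →
    ∀ {x} (T : Travel P ν x) → IsPath P T → φ x ≡ flux P (C[_] P k R) T
  height-value {ν} R φ (φν≡0 , potential) {x} T path = begin
    φ x                    ≡⟨ +-identityʳ (φ x) ⟨
    φ x - 0ℤ               ≡⟨ cong (_-_ (φ x)) φν≡0 ⟨
    φ x - φ ν              ≡⟨ potential ν x T path ⟩
    flux P (C[_] P k R) T  ∎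
    where open ≡-Reasoning

  module LowEdgeTiling (reg : Regular P k) (D : Flow P)
    (D-step : ∀ {e} → EdgeOf P e → Step k (D e))
    (D-cell : ∀ i → sumOf D (cellEdges (cell i)) ≡ 0ℤ)
    (D-boundary : ∀ {e} → e ∈ boundary → D e ≡ + 1) where

    allEdges : List Edge
    allEdges = concatMap (cellEdges ∘ cell) (allFin n)

    ∈-allEdges⁺ : ∀ {e} → EdgeOf P e → e ∈ allEdges
    ∈-allEdges⁺ (i , e∈) = ∈-concatMap⁺ (cellEdges ∘ cell) (Any.map (λ { refl → e∈ }) (∈-allFin i))

    ∈-allEdges⁻ : ∀ {e} → e ∈ allEdges → EdgeOf P e
    ∈-allEdges⁻ e∈ = Any.satisfied (∈-concatMap⁻ (cellEdges ∘ cell) {xs = allFin n} e∈)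

    lows : List Edge → List Edge
    lows = filter (low? k D)

    ∈-lows⁺ : ∀ {xs e} → e ∈ xs → D e ≡ + 1 - + k → e ∈ lows xs
    ∈-lows⁺ = ∈-filter⁺ (low? k D)

    ∈-lows⁻ : ∀ xs {e} → e ∈ lows xs → e ∈ xs × D e ≡ + 1 - + k
    ∈-lows⁻ xs = ∈-filter⁻ (low? k D) {xs = xs}

    length-lows-cell : ∀ i → length (lows (cellEdges (cell i))) ≡ 1
    length-lows-cell i = ℕ.*-cancelˡ-≡ _ 1 k {{regular-nonZero reg i}} (+-injective (begin
      + (k ℕ.* length (lows L))                 ≡⟨ pos-* k _ ⟩
      + k * + length (lows L)                   ≡⟨ +-identityˡ _ ⟨
      0ℤ + + k * + length (lows L)              ≡⟨ cong (_+ + k * + length (lows L)) (D-cell i) ⟨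
      sumOf D L + + k * + length (lows L)       ≡⟨ sumOf-steps k D L (All.tabulate (λ e∈ → D-step (i , e∈))) ⟩
      + length L                                ≡⟨ cong +_ (trans (length-cellEdges (cell i)) (reg i)) ⟩
      + k                                       ≡⟨ cong +_ (ℕ.*-identityʳ k) ⟨
      + (k ℕ.* 1)                               ∎))
      where
      open ≡-Reasoning
      L = cellEdges (cell i)

    low-edge-of-cell : ∀ i → ∃ λ e → lows (cellEdges (cell i)) ≡ e ∷ []
    low-edge-of-cell i with lows (cellEdges (cell i)) | length-lows-cell i
    ... | e ∷ [] | _ = e , refl

    not-boundary : ∀ e → e ∈ lows allEdges → e ∉ boundary
    not-boundary e e∈lows e∈∂ with boundary⊆ e e∈∂
    ... | i , _ = step-values-distinct k {{regular-nonZero reg i}}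
                    (trans (sym (D-boundary e∈∂)) (proj₂ (∈-lows⁻ allEdges e∈lows)))

    partition : ∀ i → ∃ λ e → e ∈ lows allEdges × InTile P e i ×
      (∀ e' → e' ∈ lows allEdges → InTile P e' i → e' ≡ e)
    partition i with low-edge-of-cell i
    ... | e , lows≡[e] = e , ∈-lows⁺ (∈-allEdges⁺ (i , e∈c)) e-low , e∈c , unique
      where
      e∈c×e-low = ∈-lows⁻ (cellEdges (cell i)) (subst (e ∈_) (sym lows≡[e]) (here refl))
      e∈c = proj₁ e∈c×e-low
      e-low = proj₂ e∈c×e-low
      unique : ∀ e' → e' ∈ lows allEdges → InTile P e' i → e' ≡ e
      unique e' e'∈lows e'∈c
        with subst (e' ∈_) lows≡[e] (∈-lows⁺ e'∈c (proj₂ (∈-lows⁻ allEdges e'∈lows)))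
      ... | here e'≡e = e'≡e

    tiling : Tiling P
    tiling = record
      { tilingEdges = lows allEdges
      ; edgeOfP     = λ e e∈ → ∈-allEdges⁻ (proj₁ (∈-lows⁻ allEdges e∈))
      ; notBoundary = not-boundary
      ; partition   = partition
      }

    C-tiling : ∀ {e} → EdgeOf P e → C[_] P k tiling e ≡ D e
    C-tiling {e} ed with e ∈? lows allEdges | D-step ed
    ... | yes e∈lows | _    = sym (proj₂ (∈-lows⁻ allEdges e∈lows))
    ... | no  _      | inj₁ De≡1   = sym De≡1
    ... | no  e∉lows | inj₂ De≡1-k = contradiction (∈-lows⁺ (∈-allEdges⁺ ed) De≡1-k) e∉lows

  potential-height : Regular P k → ∀ {ν} ψ → ψ ν ≡ 0ℤ →
    (∀ {e} → EdgeOf P e → Step k (increment ψ e)) →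
    (∀ {e} → e ∈ boundary → increment ψ e ≡ + 1) →
    ∃ λ Q → IsHeight P k ν Q ψ
  potential-height reg ψ ψν≡0 ψ-step ψ-boundary =
    tiling , ψν≡0 , λ x y T _ → sym (trans (flux-cong C-tiling T) (flux-increment ψ T))
    where
    open LowEdgeTiling reg (increment ψ) ψ-step (λ i → sumOf-increment-cellEdges ψ (cell i)) ψ-boundary

  module _ {ν : ℕ} (Q Q' : Tiling P) (φ φ' : ℕ → ℤ)
           (hQ : IsHeight P k ν Q φ) (hQ' : IsHeight P k ν Q' φ') where

    heights-congruent : ConnectedFrom P ν → ∀ {x} → VertexOf P x → + k ∣ φ x - φ' x
    heights-congruent conn {x} vx with conn x vx
    ... | T , path =
      subst (_ ∣_) (sym (cong₂ _-_ (height-value Q φ hQ T path) (height-value Q' φ' hQ' T path)))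
        (flux-congruent (λ e → steps-congruent (C-step Q e) (C-step Q' e)) T)

    choice-height : Regular P k → ∀ ψ → ψ ν ≡ 0ℤ →
      (∀ {e} → EdgeOf P e → increment ψ e ≡ increment φ e ⊎ increment ψ e ≡ increment φ' e) →
      ∃ λ Q₁ → IsHeight P k ν Q₁ ψ
    choice-height reg ψ ψν≡0 choice = potential-height reg ψ ψν≡0 ψ-step ψ-boundary
      where
      ψ-step : ∀ {e} → EdgeOf P e → Step k (increment ψ e)
      ψ-step ed = Sum.[ (λ eq → subst (Step k) (sym eq) (height-step Q φ hQ ed))
                      , (λ eq → subst (Step k) (sym eq) (height-step Q' φ' hQ' ed)) ] (choice ed)
      ψ-boundary : ∀ {e} → e ∈ boundary → increment ψ e ≡ + 1
      ψ-boundary {e} e∈∂ =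
        Sum.[ (λ eq → trans eq (trans (height-increment Q φ hQ ed) (C-boundary Q e∈∂)))
            , (λ eq → trans eq (trans (height-increment Q' φ' hQ' ed) (C-boundary Q' e∈∂))) ]
          (choice ed)
        where ed = boundary⊆ e e∈∂

    ⊔-height : Regular P k → ConnectedFrom P ν → ∃ λ Q₁ → IsHeight P k ν Q₁ (λ v → φ v ⊔ φ' v)
    ⊔-height reg conn =
      choice-height reg (λ v → φ v ⊔ φ' v) (cong₂ _⊔_ (proj₁ hQ) (proj₁ hQ')) λ {(x , y)} ed →
        ⊔-step (φ x) (φ' x) (φ y) (φ' y) (heights-congruent conn (edge-source ed))
               (height-step Q φ hQ ed) (height-step Q' φ' hQ' ed)

    ⊓-height : Regular P k → ConnectedFrom P ν → ∃ λ Q₂ → IsHeight P k ν Q₂ (λ v → φ v ⊓ φ' v)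
    ⊓-height reg conn =
      choice-height reg (λ v → φ v ⊓ φ' v) (cong₂ _⊓_ (proj₁ hQ) (proj₁ hQ')) λ {(x , y)} ed →
        ⊓-step (φ x) (φ' x) (φ y) (φ' y) (heights-congruent conn (edge-source ed))
               (height-step Q φ hQ ed) (height-step Q' φ' hQ' ed)

lemma8 : (G : GraphWithCells) (P : Polycell G) (k : ℕ) (ν : ℕ) →
    Regular P k → Contractible P →
    OnBoundary P ν → ConnectedFrom P ν →
    (Q Q' : Tiling P) (φ φ' : ℕ → ℤ) →
    IsHeight P k ν Q φ → IsHeight P k ν Q' φ' →
    (∃ λ (Q₁ : Tiling P) → IsHeight P k ν Q₁ (λ v → φ v ⊔ φ' v)) ×
    (∃ λ (Q₂ : Tiling P) → IsHeight P k ν Q₂ (λ v → φ v ⊓ φ' v))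
-- Contractibility and ν ∈ ∂P only serve to make height functions exist; here
-- φ and φ' are given.
lemma8 G P k ν reg _ _ conn Q Q' φ φ' hQ hQ' =
  ⊔-height P k Q Q' φ φ' hQ hQ' reg conn , ⊓-height P k Q Q' φ φ' hQ hQ' reg conn
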